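{- Let $G$ be a finite loopless graph (multiple edges allowed) with an even number of vertices $v_1,\dots,v_n$, and let $\overrightarrow{G}$ be an orientation of $G$ with no oriented 2-cycles. Then the sum of the absolute values of the coefficients of the polynomial $\operatorname{pff}(B_{\overrightarrow{G}}(z))$ equals $\Phi(G)$, the number of perfect matchings of $G$.
   Context: For vertices $v_i,v_j$ let $E(i,j)$ be the set of edges between them and $m(i,j)=|E(i,j)|$; let $s(G)$ be the underlying simple graph. For an orientation, $E(i,j)$ denotes the set of arrows with tail $v_i$ and head $v_j$; "no oriented 2-cycles" means that for no pair $i,j$ are both $E(i,j)$ and $E(j,i)$ nonempty. For each edge $e=\{v_i,v_j\}$ of $s(G)$ take a formal variable $z_e$. The weighted skew-symmetric adjacency matrix $B_{\overrightarrow{G}}(z)=(b_{i,j})$ has $b_{i,j}=\epsilon(i,j)\,m(i,j)\,z_{\{v_i,v_j\}}$, where $\epsilon(i,j)=1$ if $E(i,j)\neq\emptyset$, $\epsilon(i,j)=-1$ if $E(j,i)\neq\emptyset$, and $\epsilon(i,j)=0$ otherwise (so $b_{i,j}=0$ when there is no edge). A perfect matching is a set $M$ of edges such that every vertex is an endpoint of exactly one edge of $M$. For a skew-symmetric matrix $C=(c_{i,j})$ of size $2k$, its pfaffian is $\operatorname{pff}(C)=\sum_P \operatorname{sgn}(\sigma_P)\,c_{i_1,j_1}\cdots c_{i_k,j_k}$, the sum over all partitions $P=\{\{i_1,j_1\},\dots,\{i_k,j_k\}\}$ of $\{1,\dots,2k\}$ into pairs, where $\sigma_P$ is the permutation $1\mapsto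 i_1, 2\mapsto j_1,\dots,2k-1\mapsto i_k,2k\mapsto j_k$ (the term does not depend on the order within pairs). -}

module Defs where

open import Data.Nat using (ℕ; zero; suc; _+_; _<ᵇ_)
open import Data.Bool using (Bool; true; false; if_then_else_)
open import Data.Fin using (Fin; _≟_)
open import Data.Fin.Properties using (all?)
open import Data.Integer as ℤ using (ℤ; +_; -_; ∣_∣)
open import Data.List using (List; []; _∷_; _++_; map; concatMap; concat; foldr; filter; length; deduplicate)
open import Data.Nat.ListAction using (sum)
open import Data.Vec as Vec using (Vec; allFin; lookup)
open import Data.Product using (_×_; _,_; proj₁; proj₂)
open import Relation.Nullary using (Dec; yes; no; ¬_)
open import Relation.Nullary.Decidable using (_×-dec_; _⊎-dec_; ⌊_⌋)
open import Relation.Binary.PropositionalEquality using (_≡_; _≢_)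
open import Data.Sum using (_⊎_)

-- A monomial: exponent of the variable z_{{a,b}} at (a , b).
-- Monomials built below are symmetric (exponent at (a,b) = at (b,a)),
-- so z_{{a,b}} is one variable.
Mono : ℕ → Set
Mono n = Fin n → Fin n → ℕ

_≈M_ : ∀ {n} → Mono n → Mono n → Set
μ ≈M ν = ∀ a b → μ a b ≡ ν a b

_≈M?_ : ∀ {n} (μ ν : Mono n) → Dec (μ ≈M ν)
μ ≈M? ν = all? (λ a → all? (λ b → μ a b Data.Nat.≟ ν a b))

oneM : ∀ {n} → Mono n
oneM a b = 0

_·M_ : ∀ {n} → Mono n → Mono n → Mono n
(μ ·M ν) a b = μ a b + ν a b

varM : ∀ {n} → Fin n → Fin n → Mono n
varM i j a b with ((a ≟ i) ×-dec (b ≟ j)) ⊎-dec ((a ≟ j) ×-dec (b ≟ i))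
... | yes _ = 1
... | no  _ = 0

Poly : ℕ → Set
Poly n = List (ℤ × Mono n)

0P : ∀ {n} → Poly n
0P = []

constP : ∀ {n} → ℤ → Poly n
constP c = (c , oneM) ∷ []

varP : ∀ {n} → Fin n → Fin n → Poly n
varP i j = (+ 1 , varM i j) ∷ []

_+P_ : ∀ {n} → Poly n → Poly n → Poly n
p +P q = p ++ q

_*P_ : ∀ {n} → Poly n → Poly n → Poly n
p *P q = concatMap (λ s → map (λ t → (proj₁ s ℤ.* proj₁ t , proj₂ s ·M proj₂ t)) q) p

sumP : ∀ {n} → List (Poly n) → Poly n
sumP = foldr _+P_ 0P

prodP : ∀ {n} → List (Poly n) → Poly n
prodP = foldr _*P_ (constP (+ 1))

coeff : ∀ {n} → Poly n → Mono n → ℤ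
coeff p μ = foldr ℤ._+_ (+ 0) (map proj₁ (filter (λ t → proj₂ t ≈M? μ) p))

-- sum of the absolute values of the coefficients of p
-- (the monomials not occurring in the list have coefficient 0)
absCoeffSum : ∀ {n} → Poly n → ℕ
absCoeffSum p = sum (map (λ μ → ∣ coeff p μ ∣) (deduplicate _≈M?_ (map proj₂ p)))

picks : ∀ {A : Set} {m} → Vec A (suc m) → List (A × Vec A m)
picks {m = zero} (y Vec.∷ Vec.[]) = (y , Vec.[]) ∷ []
picks {m = suc m} (y Vec.∷ ys) =
  (y , ys) ∷ map (λ r → (proj₁ r , y Vec.∷ proj₂ r)) (picks ys)

pairings : ∀ {A : Set} {m} → Vec A m → List (List (A × A))
pairings {m = zero} Vec.[] = [] ∷ []
pairings {m = suc zero} _ = []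
pairings {m = suc (suc m)} (x Vec.∷ xs) =
  concatMap (λ r → map ((x , proj₁ r) ∷_) (pairings (proj₂ r))) (picks xs)

-- the sequence i1, j1, ..., ik, jk, i.e. the permutation σ_P in one-line notation
pairSeq : ∀ {n} → List (Fin n × Fin n) → List (Fin n)
pairSeq [] = []
pairSeq ((i , j) ∷ P) = i ∷ j ∷ pairSeq P

inversions : ∀ {n} → List (Fin n) → ℕ
inversions [] = 0
inversions (x ∷ xs) =
  length (filter (λ y → Data.Nat._<?_ (Data.Fin.toℕ y) (Data.Fin.toℕ x)) xs) + inversions xs

parity : ℕ → ℤ
parity zero = + 1
parity (suc k) = - parity k

sgnP : ∀ {n} → List (Fin n × Fin n) → ℤ
sgnP P = parity (inversions (pairSeq P))

pff : ∀ {n} → (Fin n → Fin n → Poly n) → Poly n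
pff {n} C = sumP (map (λ P → constP (sgnP P) *P prodP (map (λ ij → C (proj₁ ij) (proj₂ ij)) P))
                      (pairings (allFin n)))

-- Oriented multigraphs: n vertices, k arrows, arrow e has tail (tl e) and head (hd e).

arrows : ∀ {n k} → (Fin k → Fin n) → (Fin k → Fin n) → Fin n → Fin n → ℕ
arrows {k = k} tl hd i j =
  length (filter (λ e → (tl e ≟ i) ×-dec (hd e ≟ j)) (Vec.toList (allFin k)))

mult : ∀ {n k} → (Fin k → Fin n) → (Fin k → Fin n) → Fin n → Fin n → ℕ
mult tl hd i j = arrows tl hd i j + arrows tl hd j i

sgnEdge : ∀ {n k} → (Fin k → Fin n) → (Fin k → Fin n) → Fin n → Fin n → ℤ
sgnEdge tl hd i j with arrows tl hd i j | arrows tl hd j i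
... | suc _ | _ = + 1
... | zero | suc _ = - (+ 1)
... | zero | zero = + 0

Bmat : ∀ {n k} → (Fin k → Fin n) → (Fin k → Fin n) → Fin n → Fin n → Poly n
Bmat tl hd i j = constP (sgnEdge tl hd i j ℤ.* + mult tl hd i j) *P varP i j

-- Perfect matchings of G (edges = the k arrows, forgetting orientation)

allSubsets : (k : ℕ) → List (Vec Bool k)
allSubsets zero = Vec.[] ∷ []
allSubsets (suc k) = concatMap (λ s → (true Vec.∷ s) ∷ (false Vec.∷ s) ∷ []) (allSubsets k)

degIn : ∀ {n k} → (Fin k → Fin n) → (Fin k → Fin n) → Vec Bool k → Fin n → ℕ
degIn {k = k} tl hd M v =
  length (filter (λ e → (Data.Bool._≟_ (lookup M e) true) ×-dec ((tl e ≟ v) ⊎-dec (hd e ≟ v)))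
                 (Vec.toList (allFin k)))

IsPerfectMatching : ∀ {n k} → (Fin k → Fin n) → (Fin k → Fin n) → Vec Bool k → Set
IsPerfectMatching tl hd M = ∀ v → degIn tl hd M v ≡ 1

isPerfectMatching? : ∀ {n k} (tl hd : Fin k → Fin n) (M : Vec Bool k) → Dec (IsPerfectMatching tl hd M)
isPerfectMatching? tl hd M = all? (λ v → degIn tl hd M v Data.Nat.≟ 1)

Φ : ∀ {n k} → (Fin k → Fin n) → (Fin k → Fin n) → ℕ
Φ {k = k} tl hd = length (filter (isPerfectMatching? tl hd) (allSubsets k))

{-# OPTIONS --safe #-}
-- Expanding the pfaffian, each pairing P of the vertices contributes a single term: the monomial
-- ∏_{{i,j} ∈ P} z_{ij} with coefficient ± ∏ ε(i,j) m(i,j).  A pairing is determined by its monomial,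
-- so nothing cancels and the sum of the absolute values of the coefficients is ∑_P ∏ m(i,j).  This
-- sum counts perfect matchings.  More generally, for a list of distinct vertices, the edge sets with
-- degree 1 on the list and 0 elsewhere are counted by induction on the list: for its first vertex x,
-- double counting the pairs (M, e) with e ∈ M incident to x gives the sum over the partners z of x of
-- m(x,z) times the count for the list without x and z, which is the recursion defining the pairings.

module Submission where

open import Defs
open import Data.Bool as Bool using (Bool; true; false; not)
open import Data.Empty using (⊥-elim)
open import Data.Fin as Fin using (Fin; zero; suc)
import Data.Fin.Properties as Fin
open import Data.Integer as ℤ using (ℤ; ∣_∣)
import Data.Integer.Properties as ℤ
open import Data.List as List using (List; []; _∷_; _++_; map; concatMap; filter; length; deduplicate)
import Data.List.Properties as List
open import Data.List.Membership.Propositional using (_∈_)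
open import Data.List.Relation.Unary.All as All using (All; []; _∷_)
import Data.List.Relation.Unary.All.Properties as All
open import Data.List.Relation.Unary.AllPairs as AllPairs using (AllPairs; []; _∷_)
import Data.List.Relation.Unary.AllPairs.Properties as AllPairs
open import Data.List.Relation.Unary.Any using (here; there)
open import Data.Nat hiding (parity)
open import Data.Nat.ListAction using (sum)
open import Data.Nat.ListAction.Properties using (sum-++)
open import Data.Nat.Properties
open import Algebra.Properties.CommutativeSemigroup +-commutativeSemigroup using (interchange; x∙yz≈y∙xz)
open import Data.Nat.Tactic.RingSolver using (solve-∀)
open import Data.Product using (_×_; _,_; proj₁; proj₂)
open import Data.Sum using (_⊎_; inj₁; inj₂)
open import Data.Vec as Vec using (Vec; []; _∷_; _[_]≔_; lookup)
open import Data.Vec.Membership.Propositional.Properties using (∈-allFin⁺; ∈-toList⁺)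
import Data.Vec.Properties as Vec
open import Function using (_∘_; case_of_; mk⇔)
open import Relation.Binary.PropositionalEquality
open import Relation.Nullary using (Dec; yes; no; ¬_; ¬?; does; _×-dec_; _⊎-dec_)
open import Relation.Nullary.Decidable using (dec-true; dec-false; does-⇔)
open import Relation.Unary using (Decidable)

private
  variable
    A B : Set
    n k k′ : ℕ

∑ : List A → (A → ℕ) → ℕ
∑ xs f = sum (map f xs)

syntax ∑ xs (λ x → e) = ∑[ x ∈ xs ] e

∑-cong : (xs : List A) {f g : A → ℕ} → (∀ x → f x ≡ g x) → ∑ xs f ≡ ∑ xs g
∑-cong xs f≗g = cong sum (List.map-cong f≗g xs)

∑-congᴬ : {xs : List A} {f g : A → ℕ} → All (λ x → f x ≡ g x) xs → ∑ xs f ≡ ∑ xs g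
∑-congᴬ []            = refl
∑-congᴬ (fx≡gx ∷ eqs) = cong₂ _+_ fx≡gx (∑-congᴬ eqs)

∑-+ : (xs : List A) (f g : A → ℕ) → ∑[ x ∈ xs ] (f x + g x) ≡ ∑ xs f + ∑ xs g
∑-+ []       f g = refl
∑-+ (x ∷ xs) f g = trans (cong (f x + g x +_) (∑-+ xs f g)) (interchange (f x) (g x) _ _)

∑-*ˡ : (xs : List A) (c : ℕ) (f : A → ℕ) → ∑[ x ∈ xs ] (c * f x) ≡ c * ∑ xs f
∑-*ˡ []       c f = sym (*-zeroʳ c)
∑-*ˡ (x ∷ xs) c f = trans (cong (c * f x +_) (∑-*ˡ xs c f)) (sym (*-distribˡ-+ c (f x) _))

∑-zero : (xs : List A) → ∑[ x ∈ xs ] 0 ≡ 0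
∑-zero []       = refl
∑-zero (x ∷ xs) = ∑-zero xs

∑-++ : (xs ys : List A) (f : A → ℕ) → ∑ (xs ++ ys) f ≡ ∑ xs f + ∑ ys f
∑-++ xs ys f = trans (cong sum (List.map-++ f xs ys)) (sum-++ (map f xs) (map f ys))

∑-map : (g : A → B) (xs : List A) (f : B → ℕ) → ∑ (map g xs) f ≡ ∑ xs (f ∘ g)
∑-map g xs f = cong sum (sym (List.map-∘ xs))

∑-concatMap : (g : A → List B) (xs : List A) (f : B → ℕ) → ∑ (concatMap g xs) f ≡ ∑[ x ∈ xs ] ∑ (g x) f
∑-concatMap g []       f = refl
∑-concatMap g (x ∷ xs) f = trans (∑-++ (g x) _ f) (cong (∑ (g x) f +_) (∑-concatMap g xs f))

∑-comm : (xs : List A) (ys : List B) (f : A → B → ℕ) →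
         ∑[ x ∈ xs ] ∑ ys (f x) ≡ ∑[ y ∈ ys ] ∑[ x ∈ xs ] f x y
∑-comm []       ys f = sym (∑-zero ys)
∑-comm (x ∷ xs) ys f = trans (cong (∑ ys (f x) +_) (∑-comm xs ys f)) (sym (∑-+ ys (f x) _))

∑-∑-factor : (xs : List A) (ys : List B) (a : A → ℕ) (b : A → B → ℕ) (g : B → ℕ) →
             ∑[ x ∈ xs ] (a x * ∑[ y ∈ ys ] (b x y * g y)) ≡ ∑[ y ∈ ys ] (∑[ x ∈ xs ] (a x * b x y) * g y)
∑-∑-factor xs ys a b g = begin
  ∑[ x ∈ xs ] (a x * ∑[ y ∈ ys ] (b x y * g y))
    ≡⟨ ∑-cong xs (λ x → sym (∑-*ˡ ys (a x) _)) ⟩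
  ∑[ x ∈ xs ] ∑[ y ∈ ys ] (a x * (b x y * g y))
    ≡⟨ ∑-comm xs ys _ ⟩
  ∑[ y ∈ ys ] ∑[ x ∈ xs ] (a x * (b x y * g y))
    ≡⟨ ∑-cong ys (λ y → ∑-cong xs (λ x → reorder (a x) (b x y) (g y))) ⟩
  ∑[ y ∈ ys ] ∑[ x ∈ xs ] (g y * (a x * b x y))
    ≡⟨ ∑-cong ys (λ y → ∑-*ˡ xs (g y) _) ⟩
  ∑[ y ∈ ys ] (g y * ∑[ x ∈ xs ] (a x * b x y))
    ≡⟨ ∑-cong ys (λ y → *-comm (g y) _) ⟩
  ∑[ y ∈ ys ] (∑[ x ∈ xs ] (a x * b x y) * g y) ∎
  where
  open ≡-Reasoning
  reorder : ∀ a b g → a * (b * g) ≡ g * (a * b)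
  reorder = solve-∀

∈⇒≤∑ : {xs : List A} {x : A} (f : A → ℕ) → x ∈ xs → f x ≤ ∑ xs f
∈⇒≤∑ f (here refl)  = m≤m+n _ _
∈⇒≤∑ f (there x∈xs) = ≤-trans (∈⇒≤∑ f x∈xs) (m≤n+m _ _)

bit : Bool → ℕ
bit true  = 1
bit false = 0

𝟙 : {P : Set} → Dec P → ℕ
𝟙 P? = bit (does P?)

𝟙-yes : {P : Set} (P? : Dec P) → P → 𝟙 P? ≡ 1
𝟙-yes P? p = cong bit (dec-true P? p)

𝟙-no : {P : Set} (P? : Dec P) → ¬ P → 𝟙 P? ≡ 0
𝟙-no P? ¬p = cong bit (dec-false P? ¬p)

𝟙-cong : {P Q : Set} → (P → Q) → (Q → P) → (P? : Dec P) (Q? : Dec Q) → 𝟙 P? ≡ 𝟙 Q?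
𝟙-cong to from P? Q? = cong bit (does-⇔ (mk⇔ to from) P? Q?)

𝟙-× : {P Q : Set} (P? : Dec P) (Q? : Dec Q) → 𝟙 (P? ×-dec Q?) ≡ 𝟙 P? * 𝟙 Q?
𝟙-× (yes _) (yes _) = refl
𝟙-× (yes _) (no _)  = refl
𝟙-× (no _)  _       = refl

𝟙-*ʳ : {P : Set} (P? : Dec P) {a : ℕ} → (P → a ≡ 1) → 𝟙 P? * a ≡ 𝟙 P?
𝟙-*ʳ (yes p) a≡1 = trans (+-identityʳ _) (a≡1 p)
𝟙-*ʳ (no _)  _   = refl

length-filter≡∑𝟙 : {P : A → Set} (P? : Decidable P) (xs : List A) →
                   length (filter P? xs) ≡ ∑[ x ∈ xs ] 𝟙 (P? x)
length-filter≡∑𝟙 P? []       = refl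
length-filter≡∑𝟙 P? (x ∷ xs) with P? x
... | yes _ = cong suc (length-filter≡∑𝟙 P? xs)
... | no  _ = length-filter≡∑𝟙 P? xs

δ : Fin n → Fin n → ℕ
δ a b = 𝟙 (a Fin.≟ b)

δ-refl : (a : Fin n) → δ a a ≡ 1
δ-refl a = 𝟙-yes (a Fin.≟ a) refl

δ-≢ : (a b : Fin n) → a ≢ b → δ a b ≡ 0
δ-≢ a b = 𝟙-no (a Fin.≟ b)

δ-sym : (a b : Fin n) → δ a b ≡ δ b a
δ-sym a b = 𝟙-cong sym sym (a Fin.≟ b) (b Fin.≟ a)

δ-suc : (a b : Fin n) → δ (suc a) (suc b) ≡ δ a b
δ-suc a b = 𝟙-cong Fin.suc-injective (cong suc) (suc a Fin.≟ suc b) (a Fin.≟ b)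

enumFin : (n : ℕ) → List (Fin n)
enumFin n = Vec.toList (Vec.allFin n)

enumFin-suc : (n : ℕ) → enumFin (suc n) ≡ zero ∷ map suc (enumFin n)
enumFin-suc n = trans (cong Vec.toList (Vec.allFin-map n)) (cong (zero ∷_) (Vec.toList-map suc (Vec.allFin n)))

∑-δ : (e : Fin n) (g : Fin n → ℕ) → ∑[ e′ ∈ enumFin n ] (δ e′ e * g e′) ≡ g e
∑-δ {suc n} e g = begin
  ∑[ e′ ∈ enumFin (suc n) ] (δ e′ e * g e′)
    ≡⟨ cong (λ es → ∑[ e′ ∈ es ] (δ e′ e * g e′)) (enumFin-suc n) ⟩
  δ zero e * g zero + ∑[ e′ ∈ map suc (enumFin n) ] (δ e′ e * g e′)
    ≡⟨ cong (δ zero e * g zero +_) (∑-map suc (enumFin n) _) ⟩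
  δ zero e * g zero + ∑[ e′ ∈ enumFin n ] (δ (suc e′) e * g (suc e′))
    ≡⟨ split e ⟩
  g e ∎
  where
  open ≡-Reasoning
  split : (e : Fin (suc n)) → δ zero e * g zero + ∑[ e′ ∈ enumFin n ] (δ (suc e′) e * g (suc e′)) ≡ g e
  split zero = begin
    1 * g zero + ∑[ e′ ∈ enumFin n ] (δ (suc e′) zero * g (suc e′))
      ≡⟨ cong (1 * g zero +_) (∑-cong (enumFin n) (λ e′ → cong (_* g (suc e′)) (δ-≢ (suc e′) zero λ ()))) ⟩
    1 * g zero + ∑[ e′ ∈ enumFin n ] 0
      ≡⟨ cong₂ _+_ (*-identityˡ (g zero)) (∑-zero (enumFin n)) ⟩
    g zero + 0
      ≡⟨ +-identityʳ (g zero) ⟩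
    g zero ∎
  split (suc e₀) = begin
    δ zero (suc e₀) * g zero + ∑[ e′ ∈ enumFin n ] (δ (suc e′) (suc e₀) * g (suc e′))
      ≡⟨ cong₂ _+_ (cong (_* g zero) (δ-≢ zero (suc e₀) λ ()))
                   (∑-cong (enumFin n) (λ e′ → cong (_* g (suc e′)) (δ-suc e′ e₀))) ⟩
    ∑[ e′ ∈ enumFin n ] (δ e′ e₀ * g (suc e′))
      ≡⟨ ∑-δ e₀ (g ∘ suc) ⟩
    g (suc e₀) ∎

count : Vec (Fin n) k → Fin n → ℕ
count xs v = ∑[ y ∈ Vec.toList xs ] δ y v

count-allFin : (v : Fin n) → count (Vec.allFin n) v ≡ 1
count-allFin {n} v = trans (∑-cong (enumFin n) (λ y → sym (*-identityʳ (δ y v)))) (∑-δ v (λ _ → 1))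

Distinct : Vec (Fin n) k → Set
Distinct xs = ∀ v → count xs v ≤ 1

Distinct-tail : (x : Fin n) (xs : Vec (Fin n) k) → Distinct (x ∷ xs) → Distinct xs
Distinct-tail x xs distinct v = ≤-trans (m≤n+m (count xs v) (δ x v)) (distinct v)

Distinct-head∉ : (x : Fin n) (xs : Vec (Fin n) k) → Distinct (x ∷ xs) → count xs x ≡ 0
Distinct-head∉ x xs distinct =
  n≤0⇒n≡0 (+-cancelˡ-≤ 1 _ 0 (subst (λ c → c + count xs x ≤ 1) (δ-refl x) (distinct x)))

record IsPick (xs : Vec (Fin n) (suc k)) (r : Fin n × Vec (Fin n) k) : Set where
  field count-split : ∀ v → count xs v ≡ δ (proj₁ r) v + count (proj₂ r) v

open IsPick

picks-IsPick : (xs : Vec (Fin n) (suc k)) → All (IsPick xs) (picks xs)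
picks-IsPick {k = zero}  (y ∷ []) = record { count-split = λ v → refl } ∷ []
picks-IsPick {k = suc k} (y ∷ ys) =
  record { count-split = λ v → refl } ∷ All.map⁺ (All.map moveHead (picks-IsPick ys))
  where
  moveHead : {r : Fin _ × Vec (Fin _) k} → IsPick ys r → IsPick (y ∷ ys) (proj₁ r , y ∷ proj₂ r)
  moveHead {z , rest} isPick .count-split v =
    trans (cong (δ y v +_) (isPick .count-split v)) (x∙yz≈y∙xz (δ y v) (δ z v) _)

∑-picks-δ : (xs : Vec (Fin n) (suc k)) (z : Fin n) → ∑[ r ∈ picks xs ] δ (proj₁ r) z ≡ count xs z
∑-picks-δ {k = zero}  (y ∷ []) z = refl
∑-picks-δ {k = suc k} (y ∷ ys) z =
  cong (δ y z +_) (trans (∑-map _ (picks ys) (λ r → δ (proj₁ r) z)) (∑-picks-δ ys z))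

module _ {xs : Vec (Fin n) (suc k)} {z : Fin n} {rest : Vec (Fin n) k} (isPick : IsPick xs (z , rest)) where

  IsPick-count-rest : (v : Fin n) → count rest v ≤ count xs v
  IsPick-count-rest v = subst (count rest v ≤_) (sym (isPick .count-split v)) (m≤n+m _ _)

  IsPick-Distinct : Distinct xs → Distinct rest
  IsPick-Distinct distinct v = ≤-trans (IsPick-count-rest v) (distinct v)

  IsPick-head≢ : {x : Fin n} → count xs x ≡ 0 → z ≢ x
  IsPick-head≢ x∉xs refl with trans (sym x∉xs) (trans (isPick .count-split z) (cong (_+ count rest z) (δ-refl z)))
  ... | ()

picks-heads-distinct : (xs : Vec (Fin n) (suc k)) → Distinct xs →
                       AllPairs (λ r r′ → proj₁ r ≢ proj₁ r′) (picks xs)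
picks-heads-distinct {k = zero}  (y ∷ []) _        = [] ∷ []
picks-heads-distinct {k = suc k} (y ∷ ys) distinct =
  All.map⁺ (All.map (λ isPick → ≢-sym (IsPick-head≢ isPick (Distinct-head∉ y ys distinct))) (picks-IsPick ys))
  ∷ AllPairs.map⁺ (picks-heads-distinct ys (Distinct-tail y ys distinct))

Pairing : ℕ → Set
Pairing n = List (Fin n × Fin n)

weight : (tl hd : Fin k → Fin n) → Pairing n → ℕ
weight tl hd []            = 1
weight tl hd ((i , j) ∷ P) = mult tl hd i j * weight tl hd P

∑-pairings-∷ : (tl hd : Fin k → Fin n) (x : Fin n) (xs : Vec (Fin n) (suc k′)) →
               ∑ (pairings (x ∷ xs)) (weight tl hd)
                 ≡ ∑[ r ∈ picks xs ] (mult tl hd x (proj₁ r) * ∑ (pairings (proj₂ r)) (weight tl hd))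
∑-pairings-∷ tl hd x xs = trans (∑-concatMap _ (picks xs) (weight tl hd)) (∑-cong (picks xs) λ r →
  trans (∑-map ((x , proj₁ r) ∷_) (pairings (proj₂ r)) (weight tl hd))
        (∑-*ˡ (pairings (proj₂ r)) (mult tl hd x (proj₁ r)) (weight tl hd)))

-- Counting edge sets with prescribed degrees

∑-allSubsets-suc : (k : ℕ) (f : Vec Bool (suc k) → ℕ) →
                   ∑ (allSubsets (suc k)) f ≡ ∑[ s ∈ allSubsets k ] (f (true ∷ s) + f (false ∷ s))
∑-allSubsets-suc k f =
  trans (∑-concatMap _ (allSubsets k) f) (∑-cong (allSubsets k) (λ s → cong (f (true ∷ s) +_) (+-identityʳ _)))

∑-allSubsets-insert : (e : Fin k) (φ : Vec Bool k → ℕ) →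
                      ∑[ M ∈ allSubsets k ] (bit (lookup M e) * φ M)
                        ≡ ∑[ M ∈ allSubsets k ] (bit (not (lookup M e)) * φ (M [ e ]≔ true))
∑-allSubsets-insert {suc k} zero φ =
  trans (∑-allSubsets-suc k (λ M → bit (lookup M zero) * φ M))
        (trans (∑-cong (allSubsets k) (λ s → +-identityʳ _))
               (sym (∑-allSubsets-suc k (λ M → bit (not (lookup M zero)) * φ (M [ zero ]≔ true)))))
∑-allSubsets-insert {suc k} (suc e) φ = begin
  ∑[ M ∈ allSubsets (suc k) ] (bit (lookup M (suc e)) * φ M)
    ≡⟨ ∑-allSubsets-suc k _ ⟩
  ∑[ s ∈ allSubsets k ] (bit (lookup s e) * φ (true ∷ s) + bit (lookup s e) * φ (false ∷ s))
    ≡⟨ ∑-+ (allSubsets k) _ _ ⟩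
  ∑[ s ∈ allSubsets k ] (bit (lookup s e) * φ (true ∷ s))
    + ∑[ s ∈ allSubsets k ] (bit (lookup s e) * φ (false ∷ s))
    ≡⟨ cong₂ _+_ (∑-allSubsets-insert e (φ ∘ (true ∷_))) (∑-allSubsets-insert e (φ ∘ (false ∷_))) ⟩
  ∑[ s ∈ allSubsets k ] (bit (not (lookup s e)) * φ (true ∷ (s [ e ]≔ true)))
    + ∑[ s ∈ allSubsets k ] (bit (not (lookup s e)) * φ (false ∷ (s [ e ]≔ true)))
    ≡⟨ sym (∑-+ (allSubsets k) _ _) ⟩
  ∑[ s ∈ allSubsets k ] (bit (not (lookup s e)) * φ (true ∷ (s [ e ]≔ true))
                         + bit (not (lookup s e)) * φ (false ∷ (s [ e ]≔ true)))
    ≡⟨ sym (∑-allSubsets-suc k _) ⟩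
  ∑[ M ∈ allSubsets (suc k) ] (bit (not (lookup M (suc e))) * φ (M [ suc e ]≔ true)) ∎
  where open ≡-Reasoning

Empty : Vec Bool k → Set
Empty M = ∀ e → lookup M e ≡ false

empty? : (M : Vec Bool k) → Dec (Empty M)
empty? M = Fin.all? (λ e → lookup M e Bool.≟ false)

∑-allSubsets-empty : (k : ℕ) → ∑[ M ∈ allSubsets k ] 𝟙 (empty? M) ≡ 1
∑-allSubsets-empty zero    = refl
∑-allSubsets-empty (suc k) =
  trans (∑-allSubsets-suc k _) (trans (∑-cong (allSubsets k) rows) (∑-allSubsets-empty k))
  where
  rows : ∀ s → 𝟙 (empty? (true ∷ s)) + 𝟙 (empty? (false ∷ s)) ≡ 𝟙 (empty? s)
  rows s = cong₂ _+_ (𝟙-no (empty? (true ∷ s)) (λ empty → case empty zero of λ ()))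
                     (𝟙-cong (λ empty e → empty (suc e)) (λ { empty zero → refl ; empty (suc e) → empty e })
                             (empty? (false ∷ s)) (empty? s))

bit-insert : (M : Vec Bool k) (e : Fin k) → lookup M e ≡ false →
             (e′ : Fin k) → bit (lookup (M [ e ]≔ true) e′) ≡ bit (lookup M e′) + δ e′ e
bit-insert M e e∉M e′ with e′ Fin.≟ e
... | yes refl = trans (cong bit (Vec.lookup∘update e M true)) (cong (λ b → bit b + 1) (sym e∉M))
... | no e′≢e  = trans (cong bit (Vec.lookup∘update′ e′≢e M true)) (sym (+-identityʳ _))

module Factors {n k : ℕ} (tl hd : Fin k → Fin n) (loopless : ∀ e → tl e ≢ hd e) where

  inc : Fin k → Fin n → ℕ
  inc e v = δ (tl e) v + δ (hd e) v

  1≤inc-tl : (e : Fin k) → 1 ≤ inc e (tl e)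
  1≤inc-tl e = subst (λ c → 1 ≤ c + δ (hd e) (tl e)) (sym (δ-refl (tl e))) (s≤s z≤n)

  deg : Vec Bool k → Fin n → ℕ
  deg = degIn tl hd

  deg-∑ : (M : Vec Bool k) (v : Fin n) → deg M v ≡ ∑[ e ∈ enumFin k ] (bit (lookup M e) * inc e v)
  deg-∑ M v = trans (length-filter≡∑𝟙 _ (enumFin k)) (∑-cong (enumFin k) incidence)
    where
    -- degIn counts a loop at v once, inc counts it twice.
    endpoint : ∀ e → 𝟙 ((tl e Fin.≟ v) ⊎-dec (hd e Fin.≟ v)) ≡ inc e v
    endpoint e with tl e Fin.≟ v | hd e Fin.≟ v
    ... | yes tl≡v | yes hd≡v = ⊥-elim (loopless e (trans tl≡v (sym hd≡v)))
    ... | yes _    | no _     = refl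
    ... | no _     | _        = refl
    incidence : ∀ e → 𝟙 ((lookup M e Bool.≟ true) ×-dec ((tl e Fin.≟ v) ⊎-dec (hd e Fin.≟ v)))
                      ≡ bit (lookup M e) * inc e v
    incidence e with lookup M e
    ... | false = refl
    ... | true  = trans (endpoint e) (sym (+-identityʳ (inc e v)))

  inc≤deg : (M : Vec Bool k) (e : Fin k) → lookup M e ≡ true → (v : Fin n) → inc e v ≤ deg M v
  inc≤deg M e e∈M v = begin
    inc e v                                         ≡⟨ sym (+-identityʳ (inc e v)) ⟩
    1 * inc e v                                     ≡⟨ cong (λ b → bit b * inc e v) (sym e∈M) ⟩
    bit (lookup M e) * inc e v                      ≤⟨ ∈⇒≤∑ (λ e → bit (lookup M e) * inc e v) e∈edges ⟩
    ∑[ e ∈ enumFin k ] (bit (lookup M e) * inc e v) ≡⟨ sym (deg-∑ M v) ⟩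
    deg M v                                         ∎
    where
    open ≤-Reasoning
    e∈edges : e ∈ enumFin k
    e∈edges = ∈-toList⁺ (∈-allFin⁺ e)

  deg-insert : (M : Vec Bool k) (e : Fin k) → lookup M e ≡ false →
               (v : Fin n) → deg (M [ e ]≔ true) v ≡ deg M v + inc e v
  deg-insert M e e∉M v = begin
    deg (M [ e ]≔ true) v
      ≡⟨ deg-∑ (M [ e ]≔ true) v ⟩
    ∑[ e′ ∈ enumFin k ] (bit (lookup (M [ e ]≔ true) e′) * inc e′ v)
      ≡⟨ ∑-cong (enumFin k) (λ e′ → trans (cong (_* inc e′ v) (bit-insert M e e∉M e′))
                                          (*-distribʳ-+ (inc e′ v) (bit (lookup M e′)) (δ e′ e))) ⟩
    ∑[ e′ ∈ enumFin k ] (bit (lookup M e′) * inc e′ v + δ e′ e * inc e′ v)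
      ≡⟨ ∑-+ (enumFin k) _ _ ⟩
    ∑[ e′ ∈ enumFin k ] (bit (lookup M e′) * inc e′ v) + ∑[ e′ ∈ enumFin k ] (δ e′ e * inc e′ v)
      ≡⟨ cong₂ _+_ (sym (deg-∑ M v)) (∑-δ e (λ e′ → inc e′ v)) ⟩
    deg M v + inc e v ∎
    where open ≡-Reasoning

  HasDegree : (Fin n → ℕ) → Vec Bool k → Set
  HasDegree d M = ∀ v → deg M v ≡ d v

  hasDegree? : (d : Fin n → ℕ) (M : Vec Bool k) → Dec (HasDegree d M)
  hasDegree? d M = Fin.all? (λ v → deg M v ≟ d v)

  -- d-factors in the graph-theoretic sense; the perfect matchings are the 1-factors.
  #factors : (Fin n → ℕ) → ℕ
  #factors d = ∑[ M ∈ allSubsets k ] 𝟙 (hasDegree? d M)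

  #factorsContaining : Fin k → (Fin n → ℕ) → ℕ
  #factorsContaining e d = ∑[ M ∈ allSubsets k ] (bit (lookup M e) * 𝟙 (hasDegree? d M))

  𝟙-hasDegree-cong : {d d′ : Fin n → ℕ} → (∀ v → d v ≡ d′ v) →
                     (M : Vec Bool k) → 𝟙 (hasDegree? d M) ≡ 𝟙 (hasDegree? d′ M)
  𝟙-hasDegree-cong d≗d′ M =
    𝟙-cong (λ hasD v → trans (hasD v) (d≗d′ v)) (λ hasD′ v → trans (hasD′ v) (sym (d≗d′ v)))
           (hasDegree? _ M) (hasDegree? _ M)

  #factors-cong : {d d′ : Fin n → ℕ} → (∀ v → d v ≡ d′ v) → #factors d ≡ #factors d′
  #factors-cong d≗d′ = ∑-cong (allSubsets k) (𝟙-hasDegree-cong d≗d′)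

  #factorsContaining-cong : (e : Fin k) {d d′ : Fin n → ℕ} → (∀ v → d v ≡ d′ v) →
                            #factorsContaining e d ≡ #factorsContaining e d′
  #factorsContaining-cong e d≗d′ =
    ∑-cong (allSubsets k) (λ M → cong (bit (lookup M e) *_) (𝟙-hasDegree-cong d≗d′ M))

  Φ≡#factors : Φ tl hd ≡ #factors (λ _ → 1)
  Φ≡#factors = length-filter≡∑𝟙 (isPerfectMatching? tl hd) (allSubsets k)

  #factors-zero : #factors (λ _ → 0) ≡ 1
  #factors-zero = trans (∑-cong (allSubsets k) λ M → 𝟙-cong (empty M) (isolated M) (hasDegree? _ M) (empty? M))
                        (∑-allSubsets-empty k)
    where
    empty : (M : Vec Bool k) → HasDegree (λ _ → 0) M → Empty M
    empty M hasD e with lookup M e in e∈M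
    ... | false = refl
    ... | true  = case ≤-trans (1≤inc-tl e) (≤-trans (inc≤deg M e e∈M (tl e)) (≤-reflexive (hasD (tl e)))) of λ ()
    isolated : (M : Vec Bool k) → Empty M → HasDegree (λ _ → 0) M
    isolated M empty v = trans (deg-∑ M v) (trans (∑-cong (enumFin k) (λ e → cong (λ b → bit b * inc e v) (empty e)))
                                                  (∑-zero (enumFin k)))

  #factors-by-edges-at : (x : Fin n) {d : Fin n → ℕ} → d x ≡ 1 →
                         #factors d ≡ ∑[ e ∈ enumFin k ] (inc e x * #factorsContaining e d)
  #factors-by-edges-at x {d} dx≡1 = begin
    ∑[ M ∈ allSubsets k ] F M
      ≡⟨ ∑-cong (allSubsets k) (λ M → sym (𝟙-*ʳ (hasDegree? d M) (λ hasD → trans (hasD x) dx≡1))) ⟩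
    ∑[ M ∈ allSubsets k ] (F M * deg M x)
      ≡⟨ ∑-cong (allSubsets k) (λ M → trans (cong (F M *_) (deg-∑ M x)) (sym (∑-*ˡ (enumFin k) (F M) _))) ⟩
    ∑[ M ∈ allSubsets k ] ∑[ e ∈ enumFin k ] (F M * (bit (lookup M e) * inc e x))
      ≡⟨ ∑-comm (allSubsets k) (enumFin k) _ ⟩
    ∑[ e ∈ enumFin k ] ∑[ M ∈ allSubsets k ] (F M * (bit (lookup M e) * inc e x))
      ≡⟨ ∑-cong (enumFin k) (λ e → ∑-cong (allSubsets k) (λ M → reorder (F M) (bit (lookup M e)) (inc e x))) ⟩
    ∑[ e ∈ enumFin k ] ∑[ M ∈ allSubsets k ] (inc e x * (bit (lookup M e) * F M))
      ≡⟨ ∑-cong (enumFin k) (λ e → ∑-*ˡ (allSubsets k) (inc e x) _) ⟩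
    ∑[ e ∈ enumFin k ] (inc e x * #factorsContaining e d) ∎
    where
    open ≡-Reasoning
    F : Vec Bool k → ℕ
    F M = 𝟙 (hasDegree? d M)
    reorder : ∀ a b c → a * (b * c) ≡ c * (b * a)
    reorder = solve-∀

  #factorsContaining-overfull : (e : Fin k) {d : Fin n → ℕ} (z : Fin n) → d z < inc e z →
                                #factorsContaining e d ≡ 0
  #factorsContaining-overfull e {d} z dz<inc = trans (∑-cong (allSubsets k) excluded) (∑-zero (allSubsets k))
    where
    excluded : ∀ M → bit (lookup M e) * 𝟙 (hasDegree? d M) ≡ 0
    excluded M with lookup M e in e∈M
    ... | false = refl
    ... | true  = trans (+-identityʳ _) (𝟙-no (hasDegree? d M) λ hasD →
                    <⇒≱ dz<inc (≤-trans (inc≤deg M e e∈M z) (≤-reflexive (hasD z))))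

  #factorsContaining-remove : (e : Fin k) {d : Fin n → ℕ} (x : Fin n) → 1 ≤ inc e x → d x ≡ 0 →
                              #factorsContaining e (λ v → inc e v + d v) ≡ #factors d
  #factorsContaining-remove e {d} x 1≤inc dx≡0 =
    trans (∑-allSubsets-insert e _) (∑-cong (allSubsets k) removeEdge)
    where
    removeEdge : ∀ M → bit (not (lookup M e)) * 𝟙 (hasDegree? (λ v → inc e v + d v) (M [ e ]≔ true))
                       ≡ 𝟙 (hasDegree? d M)
    removeEdge M with lookup M e in e∈M
    ... | true  = sym (𝟙-no (hasDegree? d M) λ hasD →
                    <⇒≱ 1≤inc (≤-trans (inc≤deg M e e∈M x) (≤-reflexive (trans (hasD x) dx≡0))))
    ... | false = trans (+-identityʳ _) (𝟙-cong
                    (λ hasD v → +-cancelʳ-≡ (inc e v) _ _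
                                  (trans (sym (deg-insert M e e∈M v)) (trans (hasD v) (+-comm (inc e v) (d v)))))
                    (λ hasD v → trans (deg-insert M e e∈M v) (trans (cong (_+ inc e v) (hasD v)) (+-comm (d v) (inc e v))))
                    (hasDegree? _ (M [ e ]≔ true)) (hasDegree? d M))

  module _ (e : Fin k) (x z : Fin n) (ends : ∀ v → inc e v ≡ δ x v + δ z v) where

    #factorsContaining-∉ : {xs : Vec (Fin n) k′} → count xs z ≡ 0 → #factorsContaining e (count (x ∷ xs)) ≡ 0
    #factorsContaining-∉ {xs = xs} z∉xs = #factorsContaining-overfull e z (begin-strict
      δ x z + count xs z  ≡⟨ cong (δ x z +_) z∉xs ⟩
      δ x z + 0           <⟨ +-monoʳ-< (δ x z) (s≤s z≤n) ⟩
      δ x z + 1           ≡⟨ cong (δ x z +_) (sym (δ-refl z)) ⟩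
      δ x z + δ z z       ≡⟨ sym (ends z) ⟩
      inc e z             ∎)
      where open ≤-Reasoning

    #factorsContaining-pick : {xs : Vec (Fin n) (suc k′)} {rest : Vec (Fin n) k′} →
                              count xs x ≡ 0 → IsPick xs (z , rest) →
                              #factorsContaining e (count (x ∷ xs)) ≡ #factors (count rest)
    #factorsContaining-pick {xs = xs} {rest} x∉xs isPick =
      trans (#factorsContaining-cong e split) (#factorsContaining-remove e x 1≤inc x∉rest)
      where
      split : ∀ v → count (x ∷ xs) v ≡ inc e v + count rest v
      split v = trans (cong (δ x v +_) (isPick .count-split v))
                      (trans (sym (+-assoc (δ x v) _ _)) (cong (_+ count rest v) (sym (ends v))))
      1≤inc : 1 ≤ inc e x
      1≤inc = subst (1 ≤_) (sym (trans (ends x) (cong (_+ δ z x) (δ-refl x)))) (s≤s z≤n)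
      x∉rest : count rest x ≡ 0
      x∉rest = n≤0⇒n≡0 (≤-trans (IsPick-count-rest isPick x) (≤-reflexive x∉xs))

    #factorsContaining-∷ : {xs : Vec (Fin n) (suc k′)} → Distinct (x ∷ xs) →
                           #factorsContaining e (count (x ∷ xs))
                             ≡ ∑[ r ∈ picks xs ] (δ z (proj₁ r) * #factors (count (proj₂ r)))
    #factorsContaining-∷ {k′ = m} {xs} distinct = sym (begin
      ∑[ r ∈ picks xs ] (δ z (proj₁ r) * #factors (count (proj₂ r)))
        ≡⟨ ∑-congᴬ (All.map (λ {r} → pickTerm r) (picks-IsPick xs)) ⟩
      ∑[ r ∈ picks xs ] (δ z (proj₁ r) * C)
        ≡⟨ ∑-cong (picks xs) (λ r → trans (*-comm _ C) (cong (C *_) (δ-sym z (proj₁ r)))) ⟩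
      ∑[ r ∈ picks xs ] (C * δ (proj₁ r) z)
        ≡⟨ trans (∑-*ˡ (picks xs) C _) (cong (C *_) (∑-picks-δ xs z)) ⟩
      C * count xs z
        ≡⟨ C*count≡C ⟩
      C ∎)
      where
      open ≡-Reasoning
      C : ℕ
      C = #factorsContaining e (count (x ∷ xs))
      pickTerm : (r : Fin n × Vec (Fin n) m) → IsPick xs r →
                 δ z (proj₁ r) * #factors (count (proj₂ r)) ≡ δ z (proj₁ r) * C
      pickTerm (z′ , rest) isPick with z Fin.≟ z′
      ... | no _     = refl
      ... | yes refl = cong (_+ 0) (sym (#factorsContaining-pick (Distinct-head∉ x xs distinct) isPick))
      C*count≡C : C * count xs z ≡ C
      C*count≡C with count xs z in z∉xs | Distinct-tail x xs distinct z
      ... | 0           | _      = trans (*-zeroʳ C) (sym (#factorsContaining-∉ {xs = xs} z∉xs))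
      ... | 1           | _      = *-identityʳ C
      ... | suc (suc _) | s≤s ()

  arrows-∑ : (x y : Fin n) → arrows tl hd x y ≡ ∑[ e ∈ enumFin k ] (δ (tl e) x * δ (hd e) y)
  arrows-∑ x y =
    trans (length-filter≡∑𝟙 _ (enumFin k)) (∑-cong (enumFin k) (λ e → 𝟙-× (tl e Fin.≟ x) (hd e Fin.≟ y)))

  mult-∑ : (x y : Fin n) → mult tl hd x y ≡ ∑[ e ∈ enumFin k ] (δ (tl e) x * δ (hd e) y)
                                          + ∑[ e ∈ enumFin k ] (δ (hd e) x * δ (tl e) y)
  mult-∑ x y =
    cong₂ _+_ (arrows-∑ x y) (trans (arrows-∑ y x) (∑-cong (enumFin k) (λ e → *-comm (δ (tl e) y) _)))

  ∑-edges-at-endpoint : (a b : Fin k → Fin n) → (∀ e v → inc e v ≡ δ (a e) v + δ (b e) v) →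
    (x : Fin n) (xs : Vec (Fin n) (suc k′)) → Distinct (x ∷ xs) →
    ∑[ e ∈ enumFin k ] (δ (a e) x * #factorsContaining e (count (x ∷ xs)))
      ≡ ∑[ r ∈ picks xs ] (∑[ e ∈ enumFin k ] (δ (a e) x * δ (b e) (proj₁ r)) * #factors (count (proj₂ r)))
  ∑-edges-at-endpoint a b ends x xs distinct =
    trans (∑-cong (enumFin k) atEdge)
          (∑-∑-factor (enumFin k) (picks xs) (λ e → δ (a e) x) (λ e r → δ (b e) (proj₁ r))
                      (λ r → #factors (count (proj₂ r))))
    where
    atEdge : ∀ e → δ (a e) x * #factorsContaining e (count (x ∷ xs))
                 ≡ δ (a e) x * ∑[ r ∈ picks xs ] (δ (b e) (proj₁ r) * #factors (count (proj₂ r)))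
    atEdge e with a e Fin.≟ x
    ... | yes refl = cong (_+ 0) (#factorsContaining-∷ e (a e) (b e) (ends e) {xs = xs} distinct)
    ... | no _     = refl

  #factors-∷ : (x : Fin n) (xs : Vec (Fin n) (suc k′)) → Distinct (x ∷ xs) →
               #factors (count (x ∷ xs)) ≡ ∑[ r ∈ picks xs ] (mult tl hd x (proj₁ r) * #factors (count (proj₂ r)))
  #factors-∷ x xs distinct = begin
    #factors (count (x ∷ xs))
      ≡⟨ #factors-by-edges-at x (cong₂ _+_ (δ-refl x) (Distinct-head∉ x xs distinct)) ⟩
    ∑[ e ∈ enumFin k ] (inc e x * C e)
      ≡⟨ trans (∑-cong (enumFin k) (λ e → *-distribʳ-+ (C e) (δ (tl e) x) (δ (hd e) x))) (∑-+ (enumFin k) _ _) ⟩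
    ∑[ e ∈ enumFin k ] (δ (tl e) x * C e) + ∑[ e ∈ enumFin k ] (δ (hd e) x * C e)
      ≡⟨ cong₂ _+_ (∑-edges-at-endpoint tl hd (λ e v → refl) x xs distinct)
                   (∑-edges-at-endpoint hd tl (λ e v → +-comm (δ (tl e) v) _) x xs distinct) ⟩
    ∑[ r ∈ picks xs ] (out r * N r) + ∑[ r ∈ picks xs ] (into r * N r)
      ≡⟨ sym (∑-+ (picks xs) _ _) ⟩
    ∑[ r ∈ picks xs ] (out r * N r + into r * N r)
      ≡⟨ ∑-cong (picks xs) (λ r → trans (sym (*-distribʳ-+ (N r) (out r) (into r)))
                                        (cong (_* N r) (sym (mult-∑ x (proj₁ r))))) ⟩
    ∑[ r ∈ picks xs ] (mult tl hd x (proj₁ r) * N r) ∎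
    where
    open ≡-Reasoning
    C : Fin k → ℕ
    C e = #factorsContaining e (count (x ∷ xs))
    N out into : Fin n × Vec (Fin n) k′ → ℕ
    N r    = #factors (count (proj₂ r))
    out r  = ∑[ e ∈ enumFin k ] (δ (tl e) x * δ (hd e) (proj₁ r))
    into r = ∑[ e ∈ enumFin k ] (δ (hd e) x * δ (tl e) (proj₁ r))

  #factors-single : (x : Fin n) → #factors (count (x ∷ [])) ≡ 0
  #factors-single x = begin
    #factors (count (x ∷ []))
      ≡⟨ #factors-by-edges-at x (cong (_+ 0) (δ-refl x)) ⟩
    ∑[ e ∈ enumFin k ] (inc e x * #factorsContaining e (count (x ∷ [])))
      ≡⟨ ∑-cong (enumFin k) (λ e → trans (cong (inc e x *_) (noEdge e)) (*-zeroʳ (inc e x))) ⟩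
    ∑[ e ∈ enumFin k ] 0
      ≡⟨ ∑-zero (enumFin k) ⟩
    0 ∎
    where
    open ≡-Reasoning
    noEdge : ∀ e → #factorsContaining e (count (x ∷ [])) ≡ 0
    noEdge e with tl e Fin.≟ x
    ... | yes refl = #factorsContaining-∉ e (tl e) (hd e) (λ v → refl) {xs = []} refl
    ... | no tl≢x  = #factorsContaining-overfull e (tl e)
                       (subst (_< inc e (tl e)) (sym (cong (_+ 0) (δ-≢ x (tl e) (≢-sym tl≢x)))) (1≤inc-tl e))

  #factors≡∑weight : (xs : Vec (Fin n) k′) → Distinct xs → #factors (count xs) ≡ ∑ (pairings xs) (weight tl hd)
  #factors≡∑weight []                 _        = #factors-zero
  #factors≡∑weight (x ∷ [])           _        = #factors-single x
  #factors≡∑weight (x ∷ xs@(_ ∷ _)) distinct = begin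
    #factors (count (x ∷ xs))
      ≡⟨ #factors-∷ x xs distinct ⟩
    ∑[ r ∈ picks xs ] (mult tl hd x (proj₁ r) * #factors (count (proj₂ r)))
      ≡⟨ ∑-congᴬ (All.map (λ {r} isPick → cong (mult tl hd x (proj₁ r) *_) (#factors≡∑weight (proj₂ r)
                             (IsPick-Distinct isPick (Distinct-tail x xs distinct))))
                          (picks-IsPick xs)) ⟩
    ∑[ r ∈ picks xs ] (mult tl hd x (proj₁ r) * ∑ (pairings (proj₂ r)) (weight tl hd))
      ≡⟨ sym (∑-pairings-∷ tl hd x xs) ⟩
    ∑ (pairings (x ∷ xs)) (weight tl hd) ∎
    where open ≡-Reasoning

  Φ≡∑weight : Φ tl hd ≡ ∑ (pairings (Vec.allFin n)) (weight tl hd)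
  Φ≡∑weight = begin
    Φ tl hd                                    ≡⟨ Φ≡#factors ⟩
    #factors (λ _ → 1)                         ≡⟨ #factors-cong (λ v → sym (count-allFin v)) ⟩
    #factors (count (Vec.allFin n))            ≡⟨ #factors≡∑weight (Vec.allFin n) (≤-reflexive ∘ count-allFin) ⟩
    ∑ (pairings (Vec.allFin n)) (weight tl hd) ∎
    where open ≡-Reasoning

-- Coefficients of polynomials with distinct monomials

module _ {n : ℕ} where

  coeff-∷-≉ : (t : ℤ × Mono n) (p : Poly n) (μ : Mono n) → ¬ proj₂ t ≈M μ → coeff (t ∷ p) μ ≡ coeff p μ
  coeff-∷-≉ t p μ t≉μ =
    cong (List.foldr ℤ._+_ (ℤ.+ 0) ∘ map proj₁) (List.filter-reject (λ s → proj₂ s ≈M? μ) t≉μ)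

  coeff-∷-head : (t : ℤ × Mono n) (p : Poly n) → All (λ s → ¬ proj₂ s ≈M proj₂ t) p →
                 coeff (t ∷ p) (proj₂ t) ≡ proj₁ t
  coeff-∷-head t p fresh = trans
    (cong (List.foldr ℤ._+_ (ℤ.+ 0) ∘ map proj₁)
      (trans (List.filter-accept (λ s → proj₂ s ≈M? proj₂ t) (λ a b → refl))
             (cong (t ∷_) (List.filter-none (λ s → proj₂ s ≈M? proj₂ t) fresh))))
    (ℤ.+-identityʳ (proj₁ t))

  deduplicate-distinct : (μs : List (Mono n)) → AllPairs (λ μ ν → ¬ μ ≈M ν) μs → deduplicate _≈M?_ μs ≡ μs
  deduplicate-distinct []       []                 = refl
  deduplicate-distinct (μ ∷ μs) (fresh ∷ distinct) =
    cong (μ ∷_) (trans (cong (filter _) (deduplicate-distinct μs distinct))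
                       (List.filter-all (λ ν → ¬? (μ ≈M? ν)) fresh))

  absCoeffSum-distinct : (p : Poly n) → AllPairs (λ s t → ¬ proj₂ s ≈M proj₂ t) p →
                         absCoeffSum p ≡ ∑[ t ∈ p ] ∣ proj₁ t ∣
  absCoeffSum-distinct p distinct = begin
    absCoeffSum p
      ≡⟨ cong (λ μs → ∑[ μ ∈ μs ] ∣ coeff p μ ∣)
              (deduplicate-distinct (map proj₂ p) (AllPairs.map⁺ distinct)) ⟩
    ∑[ μ ∈ map proj₂ p ] ∣ coeff p μ ∣
      ≡⟨ ∑-map proj₂ p _ ⟩
    ∑[ t ∈ p ] ∣ coeff p (proj₂ t) ∣
      ≡⟨ coefficients p distinct ⟩
    ∑[ t ∈ p ] ∣ proj₁ t ∣ ∎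
    where
    open ≡-Reasoning
    coefficients : (q : Poly n) → AllPairs (λ s t → ¬ proj₂ s ≈M proj₂ t) q →
                   ∑[ t ∈ q ] ∣ coeff q (proj₂ t) ∣ ≡ ∑[ t ∈ q ] ∣ proj₁ t ∣
    coefficients []      []                 = refl
    coefficients (t ∷ q) (fresh ∷ distinct) = cong₂ _+_
      (cong ∣_∣ (coeff-∷-head t q (All.map (λ t≉s s≈t → t≉s (λ a b → sym (s≈t a b))) fresh)))
      (trans (∑-congᴬ (All.map (λ {s} t≉s → cong ∣_∣ (coeff-∷-≉ t q (proj₂ s) t≉s)) fresh))
             (coefficients q distinct))

-- The pfaffian of B

monomial : Pairing n → Mono n
monomial []            = oneM
monomial ((i , j) ∷ P) = (oneM ·M varM i j) ·M monomial P

∣parity∣ : (m : ℕ) → ∣ parity m ∣ ≡ 1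
∣parity∣ zero    = refl
∣parity∣ (suc m) = trans (ℤ.∣-i∣≡∣i∣ (parity m)) (∣parity∣ m)

module _ (tl hd : Fin k → Fin n) where

  -- Shaped like the terms that _*P_ produces, so that prodP-Bmat holds by computation.
  coefficient : Pairing n → ℤ
  coefficient []            = ℤ.+ 1
  coefficient ((i , j) ∷ P) = ((sgnEdge tl hd i j ℤ.* ℤ.+ mult tl hd i j) ℤ.* ℤ.+ 1) ℤ.* coefficient P

  pfaffianTerm : Pairing n → ℤ × Mono n
  pfaffianTerm P = (sgnP P ℤ.* coefficient P , oneM ·M monomial P)

  prodP-Bmat : (P : Pairing n) →
               prodP (map (λ ij → Bmat tl hd (proj₁ ij) (proj₂ ij)) P) ≡ (coefficient P , monomial P) ∷ []
  prodP-Bmat []            = refl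
  prodP-Bmat ((i , j) ∷ P) rewrite prodP-Bmat P = refl

  pff-Bmat : pff (Bmat tl hd) ≡ map pfaffianTerm (pairings (Vec.allFin n))
  pff-Bmat = sumP-singletons (pairings (Vec.allFin n))
    where
    sumP-singletons : (Ps : List (Pairing n)) →
                      sumP (map (λ P → constP (sgnP P) *P prodP (map (λ ij → Bmat tl hd (proj₁ ij) (proj₂ ij)) P)) Ps)
                        ≡ map pfaffianTerm Ps
    sumP-singletons []       = refl
    sumP-singletons (P ∷ Ps) rewrite prodP-Bmat P = cong (pfaffianTerm P ∷_) (sumP-singletons Ps)

  ∣sgnEdge∣*mult : (i j : Fin n) → ∣ sgnEdge tl hd i j ∣ * mult tl hd i j ≡ mult tl hd i j
  ∣sgnEdge∣*mult i j with arrows tl hd i j | arrows tl hd j i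
  ... | suc _ | _     = +-identityʳ _
  ... | zero  | suc _ = +-identityʳ _
  ... | zero  | zero  = refl

  ∣coefficient∣ : (P : Pairing n) → ∣ coefficient P ∣ ≡ weight tl hd P
  ∣coefficient∣ []            = refl
  ∣coefficient∣ ((i , j) ∷ P) = begin
    ∣ (εm ℤ.* ℤ.+ 1) ℤ.* coefficient P ∣
      ≡⟨ ℤ.abs-* (εm ℤ.* ℤ.+ 1) (coefficient P) ⟩
    ∣ εm ℤ.* ℤ.+ 1 ∣ * ∣ coefficient P ∣
      ≡⟨ cong (_* ∣ coefficient P ∣) (trans (ℤ.abs-* εm (ℤ.+ 1)) (*-identityʳ ∣ εm ∣)) ⟩
    ∣ εm ∣ * ∣ coefficient P ∣
      ≡⟨ cong₂ _*_ (trans (ℤ.abs-* (sgnEdge tl hd i j) _) (∣sgnEdge∣*mult i j)) (∣coefficient∣ P) ⟩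
    mult tl hd i j * weight tl hd P ∎
    where
    open ≡-Reasoning
    εm : ℤ
    εm = sgnEdge tl hd i j ℤ.* ℤ.+ mult tl hd i j

  ∣pfaffianTerm∣ : (P : Pairing n) → ∣ proj₁ (pfaffianTerm P) ∣ ≡ weight tl hd P
  ∣pfaffianTerm∣ P = trans (ℤ.abs-* (sgnP P) (coefficient P))
                           (trans (cong₂ _*_ (∣parity∣ (inversions (pairSeq P))) (∣coefficient∣ P)) (*-identityˡ _))

-- Distinct pairings have distinct monomials

varM-diag : (i j : Fin n) → varM i j i j ≡ 1
varM-diag i j with ((i Fin.≟ i) ×-dec (j Fin.≟ j)) ⊎-dec ((i Fin.≟ j) ×-dec (j Fin.≟ i))
... | yes _ = refl
... | no ¬p = ⊥-elim (¬p (inj₁ (refl , refl)))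

varM-off : (i j a b : Fin n) → ¬ ((a ≡ i × b ≡ j) ⊎ (a ≡ j × b ≡ i)) → varM i j a b ≡ 0
varM-off i j a b off with ((a Fin.≟ i) ×-dec (b Fin.≟ j)) ⊎-dec ((a Fin.≟ j) ×-dec (b Fin.≟ i))
... | yes on = ⊥-elim (off on)
... | no _   = refl

varM≤δ+δ : (i j a b : Fin n) → varM i j a b ≤ δ i a + δ j a
varM≤δ+δ i j a b with ((a Fin.≟ i) ×-dec (b Fin.≟ j)) ⊎-dec ((a Fin.≟ j) ×-dec (b Fin.≟ i))
... | yes (inj₁ (refl , _)) = ≤-trans (≤-reflexive (sym (δ-refl a))) (m≤m+n (δ a a) (δ j a))
... | yes (inj₂ (refl , _)) = ≤-trans (≤-reflexive (sym (δ-refl a))) (m≤n+m (δ a a) (δ i a))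
... | no _                  = z≤n

monomial-bounded : (xs : Vec (Fin n) k) → All (λ P → ∀ a b → monomial P a b ≤ count xs a) (pairings xs)
monomial-bounded []                         = (λ a b → z≤n) ∷ []
monomial-bounded (x ∷ [])                   = []
monomial-bounded {n = n} (x ∷ xs@(_ ∷ _)) =
  All.concat⁺ (All.map⁺ (All.map (λ {r} isPick → All.map⁺ (All.map (λ {P} → extend r isPick {P})
                                                                   (monomial-bounded (proj₂ r))))
                                 (picks-IsPick xs)))
  where
  extend : ∀ r → IsPick xs r → {P : Pairing n} → (∀ a b → monomial P a b ≤ count (proj₂ r) a) →
           ∀ a b → monomial ((x , proj₁ r) ∷ P) a b ≤ count (x ∷ xs) a
  extend (z , rest) isPick {P} bounded a b = begin
    varM x z a b + monomial P a b   ≤⟨ +-mono-≤ (varM≤δ+δ x z a b) (bounded a b) ⟩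
    δ x a + δ z a + count rest a    ≡⟨ +-assoc (δ x a) (δ z a) _ ⟩
    δ x a + (δ z a + count rest a)  ≡⟨ cong (δ x a +_) (sym (isPick .count-split a)) ⟩
    count (x ∷ xs) a                ∎
    where open ≤-Reasoning

monomials-distinct : (xs : Vec (Fin n) k) → Distinct xs → AllPairs (λ P Q → ¬ monomial P ≈M monomial Q) (pairings xs)
monomials-distinct []                       _        = [] ∷ []
monomials-distinct (x ∷ [])                 _        = []
monomials-distinct {n = n} (x ∷ xs@(_ ∷ _)) distinct =
  AllPairs.concat⁺ (All.map⁺ (All.map samePick (picks-IsPick xs)))
                   (AllPairs.map⁺ (AllPairs.zipWith differentPicks
                     (picks-heads-distinct xs distinctTail , laterPicks (picks-IsPick xs))))
  where
  distinctTail : Distinct xs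
  distinctTail = Distinct-tail x xs distinct
  x∉xs : count xs x ≡ 0
  x∉xs = Distinct-head∉ x xs distinct
  withPick : Fin n × Vec (Fin n) _ → List (Pairing n)
  withPick r = map ((x , proj₁ r) ∷_) (pairings (proj₂ r))
  samePick : ∀ {r} → IsPick xs r → AllPairs (λ P Q → ¬ monomial P ≈M monomial Q) (withPick r)
  samePick {r} isPick = AllPairs.map⁺ (AllPairs.map
    (λ P≉Q P′≈Q′ → P≉Q (λ a b → +-cancelˡ-≡ (varM x (proj₁ r) a b) _ _ (P′≈Q′ a b)))
    (monomials-distinct (proj₂ r) (IsPick-Distinct isPick distinctTail)))
  differentPicks : ∀ {r r′} → proj₁ r ≢ proj₁ r′ × IsPick xs r′ →
                   All (λ P → All (λ Q → ¬ monomial P ≈M monomial Q) (withPick r′)) (withPick r)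
  differentPicks {z , rest} {z′ , rest′} (z≢z′ , isPick′) =
    All.map⁺ (All.universal (λ P → All.map⁺ (All.map (λ {Q} → separated P Q) (monomial-bounded rest′)))
                            (pairings rest))
    where
    -- The monomials differ at (x , z): z is the partner of x in the first pairing only.
    separated : (P Q : Pairing n) → (∀ a b → monomial Q a b ≤ count rest′ a) →
                ¬ monomial ((x , z) ∷ P) ≈M monomial ((x , z′) ∷ Q)
    separated P Q bounded same =
      case trans (cong (_+ monomial P x z) (sym (varM-diag x z))) (trans (same x z) (cong₂ _+_ off unused)) of λ ()
      where
      off : varM x z′ x z ≡ 0
      off = varM-off x z′ x z λ { (inj₁ (_ , z≡z′)) → z≢z′ z≡z′
                                ; (inj₂ (x≡z′ , _)) → IsPick-head≢ isPick′ x∉xs (sym x≡z′) }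
      unused : monomial Q x z ≡ 0
      unused = n≤0⇒n≡0 (≤-trans (bounded x z) (≤-trans (IsPick-count-rest isPick′ x) (≤-reflexive x∉xs)))
  laterPicks : ∀ {rs} → All (IsPick xs) rs → AllPairs (λ _ r′ → IsPick xs r′) rs
  laterPicks []       = []
  laterPicks (_ ∷ ps) = ps ∷ laterPicks ps

mainTheorem1 : (h k : ℕ) (tl hd : Fin k → Fin (2 * h))
    → (∀ e → tl e ≢ hd e)
    → (∀ e f → ¬ (tl e ≡ hd f × hd e ≡ tl f))
    → absCoeffSum (pff (Bmat tl hd)) ≡ Φ tl hd
mainTheorem1 h k tl hd loopless _ = begin
  absCoeffSum (pff (Bmat tl hd))                   ≡⟨ cong absCoeffSum (pff-Bmat tl hd) ⟩
  absCoeffSum (map (pfaffianTerm tl hd) Ps)        ≡⟨ absCoeffSum-distinct _ (AllPairs.map⁺ monomialsDistinct) ⟩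
  ∑[ t ∈ map (pfaffianTerm tl hd) Ps ] ∣ proj₁ t ∣ ≡⟨ ∑-map (pfaffianTerm tl hd) Ps _ ⟩
  ∑[ P ∈ Ps ] ∣ proj₁ (pfaffianTerm tl hd P) ∣     ≡⟨ ∑-cong Ps (∣pfaffianTerm∣ tl hd) ⟩
  ∑ Ps (weight tl hd)                              ≡⟨ sym (Factors.Φ≡∑weight tl hd loopless) ⟩
  Φ tl hd                                          ∎
  where
  open ≡-Reasoning
  Ps : List (Pairing (2 * h))
  Ps = pairings (Vec.allFin (2 * h))
  monomialsDistinct : AllPairs (λ P Q → ¬ monomial P ≈M monomial Q) Ps
  monomialsDistinct = monomials-distinct (Vec.allFin (2 * h)) (≤-reflexive ∘ count-allFin)
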